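{- If $G$ is a Left dead end with more than one good option and $b(G)>2\cdot\operatorname{flex}(G)-2$, then $G$ is an atom.
   Context: All games are short partizan combinatorial game forms; $G+H$ is the disjunctive sum. Play is misère (a player unable to move wins). Misère outcome classes are ordered $\mathscr L>\mathscr P>\mathscr R$ and $\mathscr L>\mathscr N>\mathscr R$; $G\geq H$ means that for every game $X$ the misère outcome of $G+X$ is $\geq$ that of $H+X$, $G=H$ means $G\ge H$ and $H\ge G$, and $G>H$ means $G\ge H$ and $G\ne H$. A Left dead end is a game no subposition of which (including itself) has a Left option; its options are its Right options. An option $G'$ of $G$ is good if there is no option $G''$ of $G$ with $G'>G''$; "more than one good option" means at least two pairwise unequal good options. Let $0=\{\cdot\mid\cdot\}$, $\overline{0}=0$ and $\overline{n}=\{\cdot\mid\overline{n-1}\}$; a Left dead end is an integer if it is isomorphic to some $\overline{n}$. Flexibility: $\operatorname{flex}(G)=0$ if $G$ is an integer, otherwise $1+\max\operatorname{flex}(G')$ over options $G'$. $b(G)$ is the birthday (for a Left dead end, the height of its game tree). An atom is a Left dead end $A\neq0$ such that $A=H+K$ with Left dead ends $H,K$ implies $H=0$ or $K=0$. -}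

module Defs where

open import Data.Nat as ℕ using (ℕ; zero; suc; _⊔_; _≤_)
open import Data.Fin using (Fin; splitAt) renaming (zero to fzero; suc to fsuc)
open import Data.Sum using (_⊎_; inj₁; inj₂; [_,_])
open import Data.Product using (Σ; _×_; _,_; ∃)
open import Data.Bool using (Bool; true; false; _∧_; _∨_; not)
open import Data.Empty using (⊥)
open import Data.Unit using (⊤)
open import Relation.Nullary using (¬_)
open import Relation.Binary.PropositionalEquality using (_≡_)

data Game : Set where
  mk : (nl : ℕ) → (Fin nl → Game) → (nr : ℕ) → (Fin nr → Game) → Game

zeroG : Game
zeroG = mk 0 (λ ()) 0 (λ ())

infixl 6 _+G_
_+G_ : Game → Game → Game
G@(mk nl gL nr gR) +G H@(mk ml hL mr hR) =
  mk (nl ℕ.+ ml) (λ i → [ (λ a → gL a +G H) , (λ b → G +G hL b) ] (splitAt nl i))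
     (nr ℕ.+ mr) (λ i → [ (λ a → gR a +G H) , (λ b → G +G hR b) ] (splitAt nr i))

anyF : (n : ℕ) → (Fin n → Bool) → Bool
anyF zero f = false
anyF (suc n) f = f fzero ∨ anyF n (λ i → f (fsuc i))

allF : (n : ℕ) → (Fin n → Bool) → Bool
allF zero f = true
allF (suc n) f = f fzero ∧ allF n (λ i → f (fsuc i))

maxF : (n : ℕ) → (Fin n → ℕ) → ℕ
maxF zero f = 0
maxF (suc n) f = f fzero ⊔ maxF n (λ i → f (fsuc i))

isZero : ℕ → Bool
isZero zero = true
isZero (suc _) = false

-- Misère play (a player unable to move wins).
-- leftFirst G  : Left wins G when Left moves first.
-- leftSecond G : Left wins G when Right moves first.
leftFirst leftSecond : Game → Bool
leftFirst (mk nl gL nr gR) = isZero nl ∨ anyF nl (λ i → leftSecond (gL i))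
leftSecond (mk nl gL nr gR) = not (isZero nr) ∧ allF nr (λ j → leftFirst (gR j))

data Outcome : Set where
  𝓛 𝓝 𝓟 𝓡 : Outcome

outcome : Game → Outcome
outcome G with leftFirst G | leftSecond G
... | true  | true  = 𝓛
... | true  | false = 𝓝
... | false | true  = 𝓟
... | false | false = 𝓡

data _≤O_ : Outcome → Outcome → Set where
  refl≤ : ∀ {o} → o ≤O o
  R≤N : 𝓡 ≤O 𝓝
  R≤P : 𝓡 ≤O 𝓟
  R≤L : 𝓡 ≤O 𝓛
  N≤L : 𝓝 ≤O 𝓛
  P≤L : 𝓟 ≤O 𝓛

_≥G_ : Game → Game → Set
G ≥G H = ∀ (X : Game) → outcome (H +G X) ≤O outcome (G +G X)

_≡G_ : Game → Game → Set
G ≡G H = (G ≥G H) × (H ≥G G)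

_>G_ : Game → Game → Set
G >G H = (G ≥G H) × ¬ (G ≡G H)

LeftDeadEnd : Game → Set
LeftDeadEnd (mk nl gL nr gR) = (nl ≡ 0) × (∀ j → LeftDeadEnd (gR j))

-- Good options of a Left dead end (its options are its Right options):
-- option G' is good if there is no option G'' with G' > G''.
-- at least two pairwise unequal good options
MoreThanOneGoodOption : Game → Set
MoreThanOneGoodOption (mk nl gL nr gR) =
  Σ (Fin nr) λ j → Σ (Fin nr) λ k →
    (∀ m → ¬ (gR j >G gR m)) × (∀ m → ¬ (gR k >G gR m)) × ¬ (gR j ≡G gR k)

Iso : Game → Game → Set
Iso (mk nl gL nr gR) (mk ml hL mr hR) =
  (∀ i → Σ (Fin ml) λ i' → Iso (gL i) (hL i')) ×
  (∀ i' → Σ (Fin nl) λ i → Iso (gL i) (hL i')) ×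
  (∀ j → Σ (Fin mr) λ j' → Iso (gR j) (hR j')) ×
  (∀ j' → Σ (Fin nr) λ j → Iso (gR j) (hR j'))

bar : ℕ → Game
bar zero = zeroG
bar (suc n) = mk 0 (λ ()) 1 (λ _ → bar n)

IsInteger : Game → Set
IsInteger G = Σ ℕ λ n → Iso G (bar n)

-- Flexibility, as a (functional) relation  Flex G f  ⇔  flex(G) = f:
-- flex G = 0 if G is an integer, else 1 + max of flex over all options.
Flex : Game → ℕ → Set
Flex G@(mk nl gL nr gR) zero = IsInteger G
Flex G@(mk nl gL nr gR) (suc m) =
  ¬ IsInteger G ×
  ((Σ (Fin nl) λ i → Flex (gL i) m) ⊎ (Σ (Fin nr) λ j → Flex (gR j) m)) ×
  (∀ i k → Flex (gL i) k → k ≤ m) ×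
  (∀ j k → Flex (gR j) k → k ≤ m)

birthday : Game → ℕ
birthday (mk zero gL zero gR) = 0
birthday (mk nl gL nr gR) =
  suc (maxF nl (λ i → birthday (gL i)) ⊔ maxF nr (λ j → birthday (gR j)))

IsAtom : Game → Set
IsAtom A =
  LeftDeadEnd A × ¬ (A ≡G zeroG) ×
  (∀ H K → LeftDeadEnd H → LeftDeadEnd K → A ≡G (H +G K) → (H ≡G zeroG) ⊎ (K ≡G zeroG))

{-# OPTIONS --safe #-}
-- Suppose G = H + K with H and K nonzero Left dead ends. On Left dead ends the misère order is
-- structural: A ≥ B iff every Right option of A dominates some Right option of B, and B has no
-- options when A has none (the relation _≽_; completeness uses games built from adjoints).
-- If K is an integer n̄ with n ≥ 1, then H + (n-1)‾ is an option of H + K lying below every other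
-- option, so all good options of G are equal to it and G has only one good option.
-- If neither summand is an integer, following a longest Right path of K inside H + K passes
-- through 1 + rightHeight K non-integers; such a chain transfers to G, so flex G > rightHeight K
-- and likewise flex G > rightHeight H, while b(G) ≤ rightHeight H + rightHeight K. Hence
-- b(G) ≤ 2 flex(G) - 2.
module Submission where

open import Defs
open import Data.Nat using (ℕ; zero; suc; _+_; _*_; _≤_; _<_; _≟_; z≤n; s≤s)
open import Data.Nat.Properties
  using (1+n≢0; m+n≡0⇒m≡0; m+n≡0⇒n≡0; +-comm; +-suc; +-identityʳ; +-mono-≤; +-monoˡ-≤; +-monoʳ-≤;
         ≤-trans; ≤-antisym; ≤⇒≯; m≤m⊔n; m≤n⊔m; ⊔-lub; ⊔-sel; ⊔-identityʳ; module ≤-Reasoning)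
open import Data.Fin using (Fin; splitAt; _↑ˡ_; _↑ʳ_) renaming (zero to fzero; suc to fsuc)
open import Data.Fin.Properties using (¬Fin0; splitAt-↑ˡ; splitAt-↑ʳ; all?)
open import Data.Product using (∃; _×_; _,_; proj₁; proj₂)
open import Data.Sum using (_⊎_; inj₁; inj₂; [_,_]; swap; map₂)
open import Data.Bool using (Bool; true; false; T; not)
open import Data.Bool.Properties using (T-∧; T-∨)
open import Data.Unit using (⊤; tt)
open import Data.Empty using (⊥-elim)
open import Function using (_∘_; Equivalence)
open import Relation.Nullary using (¬_; Dec; yes; no)
open import Relation.Binary.PropositionalEquality
  using (_≡_; _≢_; refl; sym; trans; cong; cong₂; subst)

open Equivalence using (to; from)

anyF⁻ : ∀ n {f : Fin n → Bool} → T (anyF n f) → ∃ λ i → T (f i)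
anyF⁻ (suc n) {f} p with to T-∨ p
... | inj₁ q = fzero , q
... | inj₂ q = let (i , r) = anyF⁻ n q in fsuc i , r

anyF⁺ : ∀ n {f : Fin n → Bool} i → T (f i) → T (anyF n f)
anyF⁺ (suc n) fzero    p = from T-∨ (inj₁ p)
anyF⁺ (suc n) (fsuc i) p = from T-∨ (inj₂ (anyF⁺ n i p))

allF⁻ : ∀ n {f : Fin n → Bool} → T (allF n f) → ∀ i → T (f i)
allF⁻ (suc n) p fzero    = proj₁ (to T-∧ p)
allF⁻ (suc n) p (fsuc i) = allF⁻ n (proj₂ (to T-∧ p)) i

allF⁺ : ∀ n {f : Fin n → Bool} → (∀ i → T (f i)) → T (allF n f)
allF⁺ zero    p = tt
allF⁺ (suc n) p = from T-∧ (p fzero , allF⁺ n (p ∘ fsuc))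

isZero⁻ : ∀ n → T (isZero n) → n ≡ 0
isZero⁻ zero _ = refl

notIsZero⁻ : ∀ n → T (not (isZero n)) → n ≢ 0
notIsZero⁻ (suc n) _ ()

notIsZero⁺ : ∀ n → n ≢ 0 → T (not (isZero n))
notIsZero⁺ zero    n≢0 = n≢0 refl
notIsZero⁺ (suc n) _   = tt

someOrAll : ∀ {n} {P Q : Fin n → Set} → (∀ i → P i ⊎ Q i) → ∃ P ⊎ (∀ i → Q i)
someOrAll {zero}  _ = inj₂ (λ ())
someOrAll {suc n} d with d fzero | someOrAll (d ∘ fsuc)
... | inj₁ p | _            = inj₁ (fzero , p)
... | inj₂ _ | inj₁ (i , p) = inj₁ (fsuc i , p)
... | inj₂ q | inj₂ qs      = inj₂ λ { fzero → q ; (fsuc i) → qs i }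

f≤maxF : ∀ n (f : Fin n → ℕ) i → f i ≤ maxF n f
f≤maxF (suc n) f fzero    = m≤m⊔n (f fzero) _
f≤maxF (suc n) f (fsuc i) = ≤-trans (f≤maxF n (f ∘ fsuc) i) (m≤n⊔m (f fzero) _)

maxF-lub : ∀ n (f : Fin n → ℕ) {c} → (∀ i → f i ≤ c) → maxF n f ≤ c
maxF-lub zero    f bound = z≤n
maxF-lub (suc n) f bound = ⊔-lub (bound fzero) (maxF-lub n (f ∘ fsuc) (bound ∘ fsuc))

maxF-attained : ∀ n (f : Fin (suc n) → ℕ) → ∃ λ j → maxF (suc n) f ≡ f j
maxF-attained zero    f = fzero , ⊔-identityʳ (f fzero)
maxF-attained (suc n) f with ⊔-sel (f fzero) (maxF (suc n) (f ∘ fsuc))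
... | inj₁ e = fzero , e
... | inj₂ e = let (j , e′) = maxF-attained n (f ∘ fsuc) in fsuc j , trans e e′

#left #right : Game → ℕ
#left  (mk nl _ _  _) = nl
#right (mk _  _ nr _) = nr

left : (G : Game) → Fin (#left G) → Game
left (mk _ gL _ _) = gL

right : (G : Game) → Fin (#right G) → Game
right (mk _ _ _ gR) = gR

infix 4 _∈ᴿ_
data _∈ᴿ_ : Game → Game → Set where
  option : ∀ {S} i → right S i ∈ᴿ S

∈ᴿ-∀ : ∀ {T S} (P : Game → Set) → (∀ i → P (right S i)) → T ∈ᴿ S → P T
∈ᴿ-∀ P all (option i) = all i

∈ᴿ-∃ : ∀ {T S} (P : Game → Set) → T ∈ᴿ S → P T → ∃ λ i → P (right S i)
∈ᴿ-∃ P (option i) p = i , p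

right-+ˡ : ∀ G H (a : Fin (#right G)) → right G a +G H ∈ᴿ G +G H
right-+ˡ (mk _ _ nr gR) H@(mk _ _ mr _) a =
  subst (_∈ᴿ _) (cong [ (λ a → gR a +G H) , _ ] (splitAt-↑ˡ nr a mr)) (option (a ↑ˡ mr))

right-+ʳ : ∀ G H (b : Fin (#right H)) → G +G right H b ∈ᴿ G +G H
right-+ʳ G@(mk _ _ nr _) (mk _ _ mr hR) b =
  subst (_∈ᴿ _) (cong [ _ , (λ b → G +G hR b) ] (splitAt-↑ʳ nr mr b)) (option (nr ↑ʳ b))

right-+-ind : ∀ G H (P : Game → Set) →
  (∀ a → P (right G a +G H)) → (∀ b → P (G +G right H b)) → ∀ i → P (right (G +G H) i)
right-+-ind (mk _ _ nr _) (mk _ _ _ _) P onG onH i with splitAt nr i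
... | inj₁ a = onG a
... | inj₂ b = onH b

leftDeadEnd-+ : ∀ G H → LeftDeadEnd G → LeftDeadEnd H → LeftDeadEnd (G +G H)
leftDeadEnd-+ G@(mk _ _ _ gR) H@(mk _ _ _ hR) (refl , dG) (refl , dH) =
  refl , right-+-ind G H LeftDeadEnd
           (λ a → leftDeadEnd-+ (gR a) H (dG a) (refl , dH))
           (λ b → leftDeadEnd-+ G (hR b) (refl , dG) (dH b))

LeftWinsFirst LeftWinsSecond : Game → Set
LeftWinsFirst  G = T (leftFirst G)
LeftWinsSecond G = T (leftSecond G)

leftWinsFirst-+⁻ : ∀ D X → LeftDeadEnd D → LeftWinsFirst (D +G X) →
  #left X ≡ 0 ⊎ ∃ λ i → LeftWinsSecond (D +G left X i)
leftWinsFirst-+⁻ (mk _ _ _ _) (mk xl _ _ _) (refl , _) wins with to T-∨ wins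
... | inj₁ noMove = inj₁ (isZero⁻ xl noMove)
... | inj₂ move   = inj₂ (anyF⁻ xl move)

leftWinsFirst-+⁺ : ∀ D X → LeftDeadEnd D →
  #left X ≡ 0 ⊎ ∃ (λ i → LeftWinsSecond (D +G left X i)) → LeftWinsFirst (D +G X)
leftWinsFirst-+⁺ (mk _ _ _ _) (mk _  _ _ _) (refl , _) (inj₁ refl)     = tt
leftWinsFirst-+⁺ (mk _ _ _ _) (mk xl _ _ _) (refl , _) (inj₂ (i , w)) =
  from (T-∨ {isZero xl}) (inj₂ (anyF⁺ xl i w))

leftWinsSecond-+⁻ : ∀ D X → LeftWinsSecond (D +G X) →
  #right D + #right X ≢ 0 ×
  (∀ a → LeftWinsFirst (right D a +G X)) × (∀ b → LeftWinsFirst (D +G right X b))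
leftWinsSecond-+⁻ D@(mk _ _ nr _) X@(mk _ _ xr _) wins =
  notIsZero⁻ (nr + xr) nonempty ,
  (λ a → ∈ᴿ-∀ LeftWinsFirst answers (right-+ˡ D X a)) ,
  (λ b → ∈ᴿ-∀ LeftWinsFirst answers (right-+ʳ D X b))
  where
  nonempty : T (not (isZero (nr + xr)))
  nonempty = proj₁ (to T-∧ wins)
  answers : ∀ i → LeftWinsFirst (right (D +G X) i)
  answers = allF⁻ (nr + xr) (proj₂ (to T-∧ wins))

leftWinsSecond-+⁺ : ∀ D X → #right D + #right X ≢ 0 →
  (∀ a → LeftWinsFirst (right D a +G X)) → (∀ b → LeftWinsFirst (D +G right X b)) →
  LeftWinsSecond (D +G X)
leftWinsSecond-+⁺ D@(mk _ _ nr _) X@(mk _ _ xr _) nonempty onD onX =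
  from T-∧ (notIsZero⁺ (nr + xr) nonempty , allF⁺ (nr + xr) (right-+-ind D X LeftWinsFirst onD onX))

outcome-≤ : ∀ G H → (LeftWinsFirst G → LeftWinsFirst H) → (LeftWinsSecond G → LeftWinsSecond H) →
  outcome G ≤O outcome H
outcome-≤ G H first second with leftFirst G | leftSecond G | leftFirst H | leftSecond H
... | true  | _     | false | _     = ⊥-elim (first tt)
... | _     | true  | _     | false = ⊥-elim (second tt)
... | true  | true  | true  | true  = refl≤
... | true  | false | true  | true  = N≤L
... | true  | false | true  | false = refl≤
... | false | true  | true  | true  = P≤L
... | false | true  | false | true  = refl≤
... | false | false | true  | true  = R≤L
... | false | false | true  | false = R≤N
... | false | false | false | true  = R≤P
... | false | false | false | false = refl≤

outcome-≤-leftWinsSecond : ∀ G H → outcome G ≤O outcome H → LeftWinsSecond G → LeftWinsSecond H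
outcome-≤-leftWinsSecond G H G≤H with leftFirst G | leftSecond G | leftFirst H | leftSecond H
outcome-≤-leftWinsSecond G H G≤H | _ | false | _ | _    = λ ()
outcome-≤-leftWinsSecond G H G≤H | _ | true  | _ | true = λ _ → tt
outcome-≤-leftWinsSecond G H () | true  | true | true  | false
outcome-≤-leftWinsSecond G H () | true  | true | false | false
outcome-≤-leftWinsSecond G H () | false | true | true  | false
outcome-≤-leftWinsSecond G H () | false | true | false | false

-- Dominance

infix 4 _≽_ _≈_
data _≽_ : Game → Game → Set where
  dominates : ∀ {A B} → (∀ j → ∃ λ j′ → right A j ≽ right B j′) → (#right A ≡ 0 → #right B ≡ 0) →
              A ≽ B

_≈_ : Game → Game → Set
A ≈ B = A ≽ B × B ≽ A

≽-right : ∀ {A B} → A ≽ B → ∀ j → ∃ λ j′ → right A j ≽ right B j′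
≽-right (dominates dom _) = dom

≽-rightless : ∀ {A B} → A ≽ B → #right A ≡ 0 → #right B ≡ 0
≽-rightless (dominates _ empty) = empty

≽-toOption : ∀ {A T S} → #right A ≢ 0 → T ∈ᴿ S → (∀ j → right A j ≽ T) → A ≽ S
≽-toOption {A} nonempty T∈S below =
  dominates (λ j → ∈ᴿ-∃ (right A j ≽_) T∈S (below j)) (⊥-elim ∘ nonempty)

≽-trans : ∀ {A B C} → A ≽ B → B ≽ C → A ≽ C
≽-trans (dominates domAB emptyAB) (dominates domBC emptyBC) =
  dominates (λ j → let (j′ , ab) = domAB j ; (j″ , bc) = domBC j′ in j″ , ≽-trans ab bc)
            (emptyBC ∘ emptyAB)

≈-sym : ∀ {A B} → A ≈ B → B ≈ A
≈-sym (A≽B , B≽A) = B≽A , A≽B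

≈-trans : ∀ {A B C} → A ≈ B → B ≈ C → A ≈ C
≈-trans (A≽B , B≽A) (B≽C , C≽B) = ≽-trans A≽B B≽C , ≽-trans C≽B B≽A

≽-+ˡ : ∀ {A B} C → A ≽ B → A +G C ≽ B +G C
≽-+ˡ {A@(mk _ _ nr gR)} {B@(mk _ _ _ _)} C@(mk _ _ _ kR) A≽B@(dominates dom empty) =
  dominates
    (right-+-ind A C (λ X → ∃ λ j → X ≽ right (B +G C) j)
      (λ a → let (b , a≽b) = dom a in ∈ᴿ-∃ (right A a +G C ≽_) (right-+ˡ B C b) (≽-+ˡ C a≽b))
      (λ c → ∈ᴿ-∃ (A +G kR c ≽_) (right-+ʳ B C c) (≽-+ˡ (kR c) A≽B)))
    (λ e → cong₂ _+_ (empty (m+n≡0⇒m≡0 nr e)) (m+n≡0⇒n≡0 nr e))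

+-comm-≽ : ∀ A B → A +G B ≽ B +G A
+-comm-≽ A@(mk _ _ nr gR) B@(mk _ _ mr hR) =
  dominates
    (right-+-ind A B (λ X → ∃ λ j → X ≽ right (B +G A) j)
      (λ a → ∈ᴿ-∃ (gR a +G B ≽_) (right-+ʳ B A a) (+-comm-≽ (gR a) B))
      (λ b → ∈ᴿ-∃ (A +G hR b ≽_) (right-+ˡ B A b) (+-comm-≽ A (hR b))))
    (trans (+-comm mr nr))

+-comm-≈ : ∀ A B → A +G B ≈ B +G A
+-comm-≈ A B = +-comm-≽ A B , +-comm-≽ B A

≽-+ʳ : ∀ {A B} C → A ≽ B → C +G A ≽ C +G B
≽-+ʳ {A} {B} C A≽B = ≽-trans (+-comm-≽ C A) (≽-trans (≽-+ˡ C A≽B) (+-comm-≽ B C))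

-- Dominance is the misère order on Left dead ends

≽-leftWinsFirst : ∀ {A B} X → LeftDeadEnd A → LeftDeadEnd B → A ≽ B →
  LeftWinsFirst (B +G X) → LeftWinsFirst (A +G X)
≽-leftWinsSecond : ∀ {A B} X → LeftDeadEnd A → LeftDeadEnd B → A ≽ B →
  LeftWinsSecond (B +G X) → LeftWinsSecond (A +G X)

≽-leftWinsFirst {A} {B} X@(mk _ xL _ _) dA dB A≽B wins =
  leftWinsFirst-+⁺ A X dA (map₂ (λ (i , answer) → i , ≽-leftWinsSecond (xL i) dA dB A≽B answer)
                                (leftWinsFirst-+⁻ B X dB wins))

≽-leftWinsSecond {A@(mk _ _ nr _)} {B@(mk _ _ _ _)} X@(mk _ _ _ xR) dA@(_ , dAR) dB@(_ , dBR)
                 A≽B@(dominates dom empty) wins =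
  let (nonempty , onB , onX) = leftWinsSecond-+⁻ B X wins in
  leftWinsSecond-+⁺ A X
    (λ e → nonempty (cong₂ _+_ (empty (m+n≡0⇒m≡0 nr e)) (m+n≡0⇒n≡0 nr e)))
    (λ a → let (b , a≽b) = dom a in ≽-leftWinsFirst X (dAR a) (dBR b) a≽b (onB b))
    (λ c → ≽-leftWinsFirst (xR c) dA dB A≽B (onX c))

≽⇒≥G : ∀ {A B} → LeftDeadEnd A → LeftDeadEnd B → A ≽ B → A ≥G B
≽⇒≥G {A} {B} dA dB A≽B X =
  outcome-≤ (B +G X) (A +G X) (≽-leftWinsFirst X dA dB A≽B) (≽-leftWinsSecond X dA dB A≽B)

≈⇒≡G : ∀ {A B} → LeftDeadEnd A → LeftDeadEnd B → A ≈ B → A ≡G B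
≈⇒≡G dA dB (A≽B , B≽A) = ≽⇒≥G dA dB A≽B , ≽⇒≥G dB dA B≽A

adjoint : Game → Game
adjoint (mk _ _ zero    _ ) = mk 1 (λ _ → zeroG) 1 (λ _ → zeroG)
adjoint (mk _ _ (suc r) gR) = mk (suc r) (adjoint ∘ gR) 1 (λ _ → zeroG)

-- Right answers Left's move to the adjoint of D^R by moving D to D^R.
¬leftWinsFirst-+-adjoint : ∀ D → LeftDeadEnd D → ¬ LeftWinsFirst (D +G adjoint D)
¬leftWinsFirst-+-adjoint D@(mk _ _ zero _) dD wins with leftWinsFirst-+⁻ D (adjoint D) dD wins
... | inj₁ ()
... | inj₂ (_ , answer) = proj₁ (leftWinsSecond-+⁻ D zeroG answer) refl
¬leftWinsFirst-+-adjoint D@(mk _ _ (suc r) gR) dD@(_ , dR) wins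
  with leftWinsFirst-+⁻ D (adjoint D) dD wins
... | inj₁ ()
... | inj₂ (i , answer) =
  let (_ , onD , _) = leftWinsSecond-+⁻ D (adjoint (gR i)) answer in
  ¬leftWinsFirst-+-adjoint (gR i) (dR i) (onD i)

Separates : Game → Game → Game → Set
Separates V A B = LeftWinsSecond (B +G V) × ¬ LeftWinsSecond (A +G V)

separates⇒¬≥G : ∀ V A B → Separates V A B → ¬ A ≥G B
separates⇒¬≥G V A B (winsB , losesA) A≥B =
  losesA (outcome-≤-leftWinsSecond (B +G V) (A +G V) (A≥B V) winsB)

separate-rightless : ∀ A B → LeftDeadEnd B → #right A ≡ 0 → #right B ≢ 0 → Separates zeroG A B
separate-rightless A@(mk _ _ nr _) B@(mk _ _ mr _) (_ , dR) refl nonempty =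
  leftWinsSecond-+⁺ B zeroG (nonempty ∘ trans (sym (+-identityʳ mr)))
    (λ b → leftWinsFirst-+⁺ (right B b) zeroG (dR b) (inj₁ refl)) (λ ()) ,
  λ wins → proj₁ (leftWinsSecond-+⁻ A zeroG wins) refl

-- V = { V_b | · }: Left answers Right's move to B^R_b by moving to V_b, while in A + V Right
-- moves to A^R_a, after which every Left move A^R_a + V_b loses.
separate-option : ∀ A B → LeftDeadEnd A → LeftDeadEnd B → #right B ≢ 0 →
  ∀ a → (∀ b → ∃ λ V → Separates V (right A a) (right B b)) → ∃ λ V → Separates V A B
separate-option A@(mk _ _ _ gR) B@(mk _ _ mr hR) (_ , dAR) (_ , dBR) nonempty a seps =
  V , winsB , losesA
  where
  V : Game
  V = mk mr (proj₁ ∘ seps) 0 (λ ())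
  winsB : LeftWinsSecond (B +G V)
  winsB = leftWinsSecond-+⁺ B V (nonempty ∘ trans (sym (+-identityʳ mr)))
    (λ b → leftWinsFirst-+⁺ (hR b) V (dBR b) (inj₂ (b , proj₁ (proj₂ (seps b))))) (λ ())
  losesA : ¬ LeftWinsSecond (A +G V)
  losesA wins with leftWinsFirst-+⁻ (gR a) V (dAR a) (proj₁ (proj₂ (leftWinsSecond-+⁻ A V wins)) a)
  ... | inj₁ noMove       = nonempty noMove
  ... | inj₂ (b , answer) = proj₂ (proj₂ (seps b)) answer

-- V = { Y | 0 } with Y = { · | (A^R_a)° }: Right moves A to A^R_a, Left must move V to Y, and
-- Right moves Y to the adjoint (A^R_a)°.
separate-adjoint : ∀ A B → LeftDeadEnd A → LeftDeadEnd B → #right B ≡ 0 → Fin (#right A) →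
  ∃ λ V → Separates V A B
separate-adjoint A@(mk _ _ _ gR) B@(mk _ _ _ _) (_ , dAR) dB refl a = V , winsB , losesA
  where
  Y V : Game
  Y = mk 0 (λ ()) 1 (λ _ → adjoint (gR a))
  V = mk 1 (λ _ → Y) 1 (λ _ → zeroG)
  winsB : LeftWinsSecond (B +G V)
  winsB = leftWinsSecond-+⁺ B V (λ ()) (λ ()) (λ _ → leftWinsFirst-+⁺ B zeroG dB (inj₁ refl))
  losesA : ¬ LeftWinsSecond (A +G V)
  losesA wins with leftWinsFirst-+⁻ (gR a) V (dAR a) (proj₁ (proj₂ (leftWinsSecond-+⁻ A V wins)) a)
  ... | inj₁ ()
  ... | inj₂ (_ , answer) =
    let (_ , _ , onY) = leftWinsSecond-+⁻ (gR a) Y answer in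
    ¬leftWinsFirst-+-adjoint (gR a) (dAR a) (onY fzero)

≽-or-separated : ∀ A B → LeftDeadEnd A → LeftDeadEnd B → A ≽ B ⊎ ∃ λ V → Separates V A B
≽-or-separated A@(mk _ _ nr gR) B@(mk _ _ mr hR) dA@(_ , dAR) dB@(_ , dBR)
  with someOrAll (λ a → swap (someOrAll (λ b → ≽-or-separated (gR a) (hR b) (dAR a) (dBR b))))
     | nr ≟ 0 | mr ≟ 0
... | inj₁ (a , seps) | _        | yes mr≡0 = inj₂ (separate-adjoint A B dA dB mr≡0 a)
... | inj₁ (a , seps) | _        | no  mr≢0 = inj₂ (separate-option A B dA dB mr≢0 a seps)
... | inj₂ dom        | yes nr≡0 | no  mr≢0 = inj₂ (zeroG , separate-rightless A B dB nr≡0 mr≢0)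
... | inj₂ dom        | yes _    | yes mr≡0 = inj₁ (dominates dom (λ _ → mr≡0))
... | inj₂ dom        | no  nr≢0 | _        = inj₁ (dominates dom (⊥-elim ∘ nr≢0))

≥G⇒≽ : ∀ {A B} → LeftDeadEnd A → LeftDeadEnd B → A ≥G B → A ≽ B
≥G⇒≽ {A} {B} dA dB A≥B with ≽-or-separated A B dA dB
... | inj₁ A≽B      = A≽B
... | inj₂ (V , sep) = ⊥-elim (separates⇒¬≥G V A B sep A≥B)

≡G⇒≈ : ∀ {A B} → LeftDeadEnd A → LeftDeadEnd B → A ≡G B → A ≈ B
≡G⇒≈ dA dB (A≥B , B≥A) = ≥G⇒≽ dA dB A≥B , ≥G⇒≽ dB dA B≥A

≽? : ∀ {A B} → LeftDeadEnd A → LeftDeadEnd B → Dec (A ≽ B)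
≽? {A} {B} dA dB with ≽-or-separated A B dA dB
... | inj₁ A≽B      = yes A≽B
... | inj₂ (V , sep) = no (separates⇒¬≥G V A B sep ∘ ≽⇒≥G dA dB)

-- Integers

IsBar : Game → ℕ → Set
IsBar G zero    = #right G ≡ 0
IsBar G (suc n) = #right G ≢ 0 × ∀ j → IsBar (right G j) n

NonInteger : Game → Set
NonInteger G = ¬ ∃ (IsBar G)

isBar-bar : ∀ n → IsBar (bar n) n
isBar-bar zero    = refl
isBar-bar (suc n) = (λ ()) , λ _ → isBar-bar n

isBar-unique : ∀ G {m n} → IsBar G m → IsBar G n → m ≡ n
isBar-unique G                   {zero}  {zero}  _              _              = refl
isBar-unique G                   {zero}  {suc n} empty          (nonempty , _) = ⊥-elim (nonempty empty)
isBar-unique G                   {suc m} {zero}  (nonempty , _) empty          = ⊥-elim (nonempty empty)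
isBar-unique (mk _ _ zero    _ ) {suc m} {suc n} (nonempty , _) _              = ⊥-elim (nonempty refl)
isBar-unique (mk _ _ (suc _) gR) {suc m} {suc n} (_ , barsₘ)    (_ , barsₙ)    =
  cong suc (isBar-unique (gR fzero) (barsₘ fzero) (barsₙ fzero))

isBar⇒iso : ∀ G n → LeftDeadEnd G → IsBar G n → Iso G (bar n)
isBar⇒iso (mk _ _ zero    _ ) zero    (refl , _) _ = (λ ()) , (λ ()) , (λ ()) , (λ ())
isBar⇒iso (mk _ _ zero    _ ) (suc n) _ (nonempty , _) = ⊥-elim (nonempty refl)
isBar⇒iso (mk _ _ (suc _) gR) (suc n) (refl , dR) (_ , bars) =
  (λ ()) , (λ ()) ,
  (λ j → fzero , isBar⇒iso (gR j) n (dR j) (bars j)) ,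
  (λ _ → fzero , isBar⇒iso (gR fzero) n (dR fzero) (bars fzero))

iso⇒isBar : ∀ G n → Iso G (bar n) → IsBar G n
iso⇒isBar (mk _ _ zero    _ ) zero    _                   = refl
iso⇒isBar (mk _ _ (suc _) _ ) zero    (_ , _ , toBar , _) = ⊥-elim (¬Fin0 (proj₁ (toBar fzero)))
iso⇒isBar (mk _ _ _       gR) (suc n) (_ , _ , toBar , fromBar) =
  (λ empty → ¬Fin0 (subst Fin empty (proj₁ (fromBar fzero)))) ,
  (λ j → iso⇒isBar (gR j) n (proj₂ (toBar j)))

isBar-≽ : ∀ G H n → IsBar G n → IsBar H n → G ≽ H
isBar-≽ (mk _ _ _ _ ) (mk _ _ _ _) zero    refl emptyH = dominates (λ ()) (λ _ → emptyH)
isBar-≽ (mk _ _ _ _ ) (mk _ _ zero _) (suc n) _ (nonempty , _) = ⊥-elim (nonempty refl)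
isBar-≽ (mk _ _ _ gR) (mk _ _ (suc _) hR) (suc n) (nonempty , barsG) (_ , barsH) =
  dominates (λ j → fzero , isBar-≽ (gR j) (hR fzero) n (barsG j) (barsH fzero)) (⊥-elim ∘ nonempty)

≽bar⇒isBar : ∀ G n → G ≽ bar n → IsBar G n
≽bar⇒isBar (mk _ _ zero    _) zero    _               = refl
≽bar⇒isBar (mk _ _ (suc _) _) zero    (dominates dom _) = ⊥-elim (¬Fin0 (proj₁ (dom fzero)))
≽bar⇒isBar (mk _ _ _ gR)      (suc n) (dominates dom empty) =
  1+n≢0 ∘ empty , λ j → ≽bar⇒isBar (gR j) n (proj₂ (dom j))

isBar-zero⇒≡G0 : ∀ G → LeftDeadEnd G → IsBar G 0 → G ≡G zeroG
isBar-zero⇒≡G0 G dG empty =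
  ≈⇒≡G dG (refl , λ ()) (isBar-≽ G zeroG 0 empty refl , isBar-≽ zeroG G 0 refl empty)

nonInteger-≽ : ∀ {G H} → G ≽ H → NonInteger G → NonInteger H
nonInteger-≽ {G} {H} G≽H nonInt (n , barH) =
  nonInt (n , ≽bar⇒isBar G n (≽-trans G≽H (isBar-≽ H (bar n) n barH (isBar-bar n))))

nonInteger⇒option : ∀ G → NonInteger G → Fin (#right G)
nonInteger⇒option (mk _ _ zero    _) nonInt = ⊥-elim (nonInt (0 , refl))
nonInteger⇒option (mk _ _ (suc _) _) _      = fzero

isBar-+-rightless : ∀ G H n → #right H ≡ 0 → IsBar (G +G H) n → IsBar G n
isBar-+-rightless (mk _ _ nr _) (mk _ _ _ _) zero refl empty = trans (sym (+-identityʳ nr)) empty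
isBar-+-rightless G@(mk _ _ nr gR) H@(mk _ _ _ _) (suc n) refl (nonempty , bars) =
  nonempty ∘ trans (+-identityʳ nr) ,
  λ a → isBar-+-rightless (gR a) H n refl (∈ᴿ-∀ (λ X → IsBar X n) bars (right-+ˡ G H a))

nonInteger-+ : ∀ G H → NonInteger G → NonInteger (G +G H)
nonInteger-+ G (mk _ _ zero _) nonInt (n , bar) = nonInt (n , isBar-+-rightless G _ n refl bar)
nonInteger-+ (mk _ _ nr _) (mk _ _ (suc _) _) _ (zero , empty) = 1+n≢0 (m+n≡0⇒n≡0 nr empty)
nonInteger-+ G H@(mk _ _ (suc _) hR) nonInt (suc n , _ , bars) =
  nonInteger-+ G (hR fzero) nonInt (n , ∈ᴿ-∀ (λ X → IsBar X n) bars (right-+ʳ G H fzero))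

integer? : ∀ G → Dec (∃ (IsBar G))
integer? (mk _ _ zero    _ ) = yes (0 , refl)
integer? (mk _ _ (suc _) gR) with all? (integer? ∘ gR)
... | no notAll = no λ { (zero , ()) ; (suc n , _ , bars) → notAll (λ j → n , bars j) }
... | yes ints with all? (λ j → proj₁ (ints j) ≟ proj₁ (ints fzero))
...   | yes same = yes (suc (proj₁ (ints fzero)) , (λ ()) ,
                        λ j → subst (IsBar (gR j)) (same j) (proj₂ (ints j)))
...   | no notSame = no λ
  { (zero , ())
  ; (suc n , _ , bars) → notSame λ j →
      trans (isBar-unique (gR j) (proj₂ (ints j)) (bars j))
            (isBar-unique (gR fzero) (bars fzero) (proj₂ (ints fzero))) }

rightHeight : Game → ℕ
rightHeight (mk _ _ nr gR) = maxF nr (λ j → suc (rightHeight (gR j)))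

rightHeight-right : ∀ G j → suc (rightHeight (right G j)) ≤ rightHeight G
rightHeight-right (mk _ _ nr gR) = f≤maxF nr (λ j → suc (rightHeight (gR j)))

birthday≤rightHeight : ∀ G → LeftDeadEnd G → birthday G ≤ rightHeight G
birthday≤rightHeight (mk _ _ zero    _ ) (refl , _ ) = z≤n
birthday≤rightHeight G@(mk _ _ (suc r) gR) (refl , dR) =
  let (j , e) = maxF-attained r (birthday ∘ gR) in
  begin
    suc (maxF (suc r) (birthday ∘ gR)) ≡⟨ cong suc e ⟩
    suc (birthday (gR j))              ≤⟨ s≤s (birthday≤rightHeight (gR j) (dR j)) ⟩
    suc (rightHeight (gR j))           ≤⟨ rightHeight-right G j ⟩
    rightHeight G                      ∎
  where open ≤-Reasoning

rightHeight-≽ : ∀ {G H} → G ≽ H → rightHeight G ≤ rightHeight H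
rightHeight-≽ {mk _ _ nr gR} {H} (dominates dom _) =
  maxF-lub nr _ λ j → let (j′ , gj≽hj′) = dom j in
    ≤-trans (s≤s (rightHeight-≽ gj≽hj′)) (rightHeight-right H j′)

rightHeight-+ : ∀ G H → rightHeight (G +G H) ≤ rightHeight G + rightHeight H
rightHeight-+ G@(mk _ _ nr gR) H@(mk _ _ mr hR) =
  maxF-lub (nr + mr) _ (right-+-ind G H (λ X → suc (rightHeight X) ≤ rightHeight G + rightHeight H)
    (λ a → ≤-trans (s≤s (rightHeight-+ (gR a) H))
                   (+-monoˡ-≤ (rightHeight H) (rightHeight-right G a)))
    (λ b → begin
      suc (rightHeight (G +G hR b))            ≤⟨ s≤s (rightHeight-+ G (hR b)) ⟩
      suc (rightHeight G + rightHeight (hR b)) ≡⟨ sym (+-suc (rightHeight G) _) ⟩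
      rightHeight G + suc (rightHeight (hR b)) ≤⟨ +-monoʳ-≤ (rightHeight G) (rightHeight-right H b) ⟩
      rightHeight G + rightHeight H            ∎))
  where open ≤-Reasoning

-- Flexibility and chains of non-integers

flex-unique : ∀ G {m n} → Flex G m → Flex G n → m ≡ n
flex-unique (mk _ _ _ _) {zero}  {zero}  _ _ = refl
flex-unique (mk _ _ _ _) {zero}  {suc n} int (nonInt , _) = ⊥-elim (nonInt int)
flex-unique (mk _ _ _ _) {suc m} {zero}  (nonInt , _) int = ⊥-elim (nonInt int)
flex-unique (mk _ gL _ gR) {suc m} {suc n}
            (_ , witnessₘ , boundLₘ , boundRₘ) (_ , witnessₙ , boundLₙ , boundRₙ) =
  cong suc (≤-antisym (bounded witnessₘ boundLₙ boundRₙ) (bounded witnessₙ boundLₘ boundRₘ))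
  where
  bounded : ∀ {k l} → (∃ λ i → Flex (gL i) k) ⊎ (∃ λ j → Flex (gR j) k) →
    (∀ i k → Flex (gL i) k → k ≤ l) → (∀ j k → Flex (gR j) k → k ≤ l) → k ≤ l
  bounded (inj₁ (i , flexᵢ)) boundL _ = boundL i _ flexᵢ
  bounded (inj₂ (j , flexⱼ)) _ boundR = boundR j _ flexⱼ

flex-exists : ∀ G → LeftDeadEnd G → ∃ (Flex G)
flex-exists (mk _ _ zero _) (refl , _) = 0 , 0 , (λ ()) , (λ ()) , (λ ()) , (λ ())
flex-exists G@(mk _ _ (suc r) gR) dG@(refl , dR) with integer? G
... | yes (n , bar) = 0 , n , isBar⇒iso G n dG bar
... | no nonInt     =
  suc (flexR j) , (λ (n , iso) → nonInt (n , iso⇒isBar G n iso)) ,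
  inj₂ (j , proj₂ (flex-exists (gR j) (dR j))) , (λ ()) ,
  λ i k flexᵢ →
    subst (_≤ flexR j) (flex-unique (gR i) (proj₂ (flex-exists (gR i) (dR i))) flexᵢ) (maximal i)
  where
  flexR : Fin (suc r) → ℕ
  flexR i = proj₁ (flex-exists (gR i) (dR i))
  j : Fin (suc r)
  j = proj₁ (maxF-attained r flexR)
  maximal : ∀ i → flexR i ≤ flexR j
  maximal i = subst (flexR i ≤_) (proj₂ (maxF-attained r flexR)) (f≤maxF (suc r) flexR i)

NonIntegerChain : Game → ℕ → Set
NonIntegerChain G zero    = ⊤
NonIntegerChain G (suc k) = NonInteger G × ∃ λ j → NonIntegerChain (right G j) k

chain≤flex : ∀ G {k f} → LeftDeadEnd G → Flex G f → NonIntegerChain G k → k ≤ f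
chain≤flex G {zero} _ _ _ = z≤n
chain≤flex G@(mk _ _ _ _) {suc k} {zero} _ (n , iso) (nonInt , _) =
  ⊥-elim (nonInt (n , iso⇒isBar G n iso))
chain≤flex (mk _ _ _ gR) {suc k} {suc m} (_ , dR) (_ , _ , _ , boundR) (_ , j , chain) =
  let (f , flexⱼ) = flex-exists (gR j) (dR j) in
  s≤s (≤-trans (chain≤flex (gR j) (dR j) flexⱼ chain) (boundR j f flexⱼ))

chain-≽ : ∀ {G H} k → G ≽ H → NonIntegerChain G k → NonIntegerChain H k
chain-≽ zero    _   _                     = tt
chain-≽ (suc k) G≽H (nonInt , j , chain) =
  let (j′ , gj≽hj′) = ≽-right G≽H j in nonInteger-≽ G≽H nonInt , j′ , chain-≽ k gj≽hj′ chain

chain-+ : ∀ G H → NonInteger G → NonIntegerChain (G +G H) (suc (rightHeight H))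
chain-+ G H@(mk _ _ zero _) nonInt =
  nonInteger-+ G H nonInt , ∈ᴿ-∃ (λ _ → ⊤) (right-+ˡ G H (nonInteger⇒option G nonInt)) tt
chain-+ G H@(mk _ _ (suc r) hR) nonInt =
  let (j , e) = maxF-attained r (λ j → suc (rightHeight (hR j))) in
  subst (NonIntegerChain (G +G H) ∘ suc) (sym e)
    (nonInteger-+ G H nonInt ,
     ∈ᴿ-∃ (λ X → NonIntegerChain X (suc (rightHeight (hR j))))
          (right-+ʳ G H j) (chain-+ G (hR j) nonInt))

-- Good options and least options

≽∧≯G⇒≼ : ∀ {A B} → LeftDeadEnd A → LeftDeadEnd B → A ≽ B → ¬ A >G B → B ≽ A
≽∧≯G⇒≼ dA dB A≽B A≯B with ≽? dB dA
... | yes B≽A = B≽A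
... | no  B⋡A = ⊥-elim (A≯B (≽⇒≥G dA dB A≽B , B⋡A ∘ ≥G⇒≽ dB dA ∘ proj₂))

IsLeastOption : Game → Game → Set
IsLeastOption T S = T ∈ᴿ S × ∀ i → right S i ≽ T

isLeastOption⇒¬twoGood : ∀ G {S T} → LeftDeadEnd G → G ≈ S → IsLeastOption T S →
  ¬ MoreThanOneGoodOption G
isLeastOption⇒¬twoGood G@(mk _ _ _ gR) {S} (_ , dR) (G≽S , S≽G) (option i₀ , least)
                       (j , k , goodⱼ , goodₖ , j≢k) =
  j≢k (≈⇒≡G (dR j) (dR k) (≈-trans (good≈T j goodⱼ) (≈-sym (good≈T k goodₖ))))
  where
  good≈T : ∀ j → (∀ m → ¬ gR j >G gR m) → gR j ≈ right S i₀
  good≈T j good =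
    let (s , j≽s) = ≽-right G≽S j
        (m , T≽m) = ≽-right S≽G i₀
        j≽T = ≽-trans j≽s (least s)
    in j≽T , ≽-trans T≽m (≽∧≯G⇒≼ (dR j) (dR m) (≽-trans j≽T T≽m) (good m))

#right-+-nonempty : ∀ G H → #right H ≢ 0 → #right (G +G H) ≢ 0
#right-+-nonempty (mk _ _ nr _) (mk _ _ _ _) nonempty = nonempty ∘ m+n≡0⇒n≡0 nr

≽-+-shift : ∀ G H H₀ → #right H ≢ 0 → (∀ b → right H b ≽ H₀) → ∀ a → right G a +G H ≽ G +G H₀
≽-+-shift G@(mk _ _ _ gR) H H₀ nonempty above a =
  ≽-toOption (#right-+-nonempty (gR a) H nonempty) (right-+ˡ G H₀ a)
    (right-+-ind (gR a) H (_≽ gR a +G H₀)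
      (≽-+-shift (gR a) H H₀ nonempty above) (λ b → ≽-+ʳ (gR a) (above b)))

isLeastOption-+-bar : ∀ G H n → IsBar H (suc n) → ∃ λ T → IsLeastOption T (G +G H)
isLeastOption-+-bar G (mk _ _ zero _) n (nonempty , _) = ⊥-elim (nonempty refl)
isLeastOption-+-bar G H@(mk _ _ (suc _) hR) n (nonempty , bars) =
  G +G hR fzero , right-+ʳ G H fzero ,
  right-+-ind G H (_≽ G +G hR fzero) (≽-+-shift G H (hR fzero) nonempty ≽H₀) (λ b → ≽-+ʳ G (≽H₀ b))
  where
  ≽H₀ : ∀ b → hR b ≽ hR fzero
  ≽H₀ b = isBar-≽ (hR b) (hR fzero) n (bars b) (bars fzero)

-- Sums of non-integers

nonIntegerSum-birthday+2≤2*flex : ∀ G H K {f} → LeftDeadEnd G → Flex G f → G ≈ H +G K →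
  NonInteger H → NonInteger K → birthday G + 2 ≤ 2 * f
nonIntegerSum-birthday+2≤2*flex G H K {f} dG flex (G≽S , S≽G) nonIntH nonIntK =
  begin
    birthday G + 2                            ≤⟨ +-monoˡ-≤ 2 heights ⟩
    rightHeight H + rightHeight K + 2         ≡⟨ +-comm _ 2 ⟩
    2 + (rightHeight H + rightHeight K)       ≡⟨ cong suc (sym (+-suc (rightHeight H) _)) ⟩
    suc (rightHeight H) + suc (rightHeight K) ≤⟨ +-mono-≤ H<f K<f ⟩
    f + f                                     ≡⟨ cong (f +_) (sym (+-identityʳ f)) ⟩
    2 * f                                     ∎
  where
  open ≤-Reasoning
  heights : birthday G ≤ rightHeight H + rightHeight K
  heights = ≤-trans (birthday≤rightHeight G dG) (≤-trans (rightHeight-≽ G≽S) (rightHeight-+ H K))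
  K<f : rightHeight K < f
  K<f = chain≤flex G dG flex (chain-≽ _ S≽G (chain-+ H K nonIntH))
  H<f : rightHeight H < f
  H<f = chain≤flex G dG flex (chain-≽ _ (≽-trans (+-comm-≽ K H) S≽G) (chain-+ K H nonIntK))

mainTheorem13 : (G : Game) → LeftDeadEnd G → MoreThanOneGoodOption G →
    (f : ℕ) → Flex G f → 2 * f < birthday G + 2 → IsAtom G
mainTheorem13 G@(mk _ _ _ _) dG twoGood f flex young = dG , G≢0 , indecomposable
  where
  G≢0 : ¬ G ≡G zeroG
  G≢0 (_ , 0≥G) = ¬Fin0 (subst Fin (≽-rightless (≥G⇒≽ (refl , λ ()) dG 0≥G) refl) (proj₁ twoGood))

  indecomposable : ∀ H K → LeftDeadEnd H → LeftDeadEnd K → G ≡G (H +G K) → H ≡G zeroG ⊎ K ≡G zeroG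
  indecomposable H K dH dK G≡S with ≡G⇒≈ dG (leftDeadEnd-+ H K dH dK) G≡S | integer? H | integer? K
  ... | _   | yes (zero , h)  | _              = inj₁ (isBar-zero⇒≡G0 H dH h)
  ... | _   | _               | yes (zero , k) = inj₂ (isBar-zero⇒≡G0 K dK k)
  ... | G≈S | _               | yes (suc n , k) =
    ⊥-elim (isLeastOption⇒¬twoGood G dG G≈S (proj₂ (isLeastOption-+-bar H K n k)) twoGood)
  ... | G≈S | yes (suc n , h) | _ =
    ⊥-elim (isLeastOption⇒¬twoGood G dG (≈-trans G≈S (+-comm-≈ H K))
                                    (proj₂ (isLeastOption-+-bar K H n h)) twoGood)
  ... | G≈S | no nonIntH      | no nonIntK =
    ⊥-elim (≤⇒≯ (nonIntegerSum-birthday+2≤2*flex G H K dG flex G≈S nonIntH nonIntK) young)
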